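{- Let $\ell\ge 2$ be an integer and $n=4\ell+2$. Then $\operatorname{capt}(H(n),2)=\ell+2(n-4)$.
   Context: All graphs are finite, simple apart from loops, connected and reflexive. The game of one cop and $m$ robbers: in round $0$ the cop chooses a starting vertex, then the robbers choose starting vertices (players may share vertices). In each round $i\ge1$ the cop moves to an adjacent vertex or stays, then every robber moves to an adjacent vertex or stays. Whenever the cop occupies the same vertex as some robbers, those robbers are captured and leave the game. For a cop-win graph $G$, $\operatorname{capt}(G,m)$ is the smallest $t$ such that the cop has a strategy guaranteeing all $m$ robbers are captured by round $t$ regardless of the robbers' play. The graph $H(7)$ has vertex set $\{1,\dots,7\}$ and edges $62,21,14$, $56,52,51,54,36,32,31,34$ and $76,74,73$. For $n\ge 8$, $H(n)$ is obtained from $H(n-1)$ by adding a vertex $n$ adjacent to $n-1$, $n-3$ and $n-4$. -}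

module Defs where

open import Level using (0ℓ)
open import Data.Nat using (ℕ; zero; suc; _+_; _<_)
open import Data.Fin using (Fin; toℕ)
open import Data.Fin.Properties using () renaming (_≟_ to _≟ᶠ_)
open import Data.List using (List; []; filter)
open import Data.List.Relation.Binary.Pointwise using (Pointwise)
open import Data.Vec using (Vec; toList)
open import Data.Product using (Σ; _×_)
open import Data.Sum using (_⊎_)
open import Relation.Nullary using (¬_; ¬?)
open import Relation.Binary.Definitions using (DecidableEquality)
open import Relation.Binary.PropositionalEquality using (_≡_)

-- A reflexive graph: vertex type with decidable equality and a
-- (reflexive, symmetric) adjacency relation.  "Move to an adjacent
-- vertex or stay" is exactly `Adj u v`.
record Graph : Set₁ where
  field
    V    : Set
    _≟_  : DecidableEquality V
    Adj  : V → V → Set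

module Game (G : Graph) where
  open Graph G

  remove : V → List V → List V
  remove c rs = filter (λ r → ¬? (r ≟ c)) rs

  -- CopWins k c rs : it is the start of a round, the cop is on c, the
  -- surviving robbers are on rs (none on c).  In each round the cop
  -- moves (capturing robbers on its new vertex), then every surviving
  -- robber moves to an adjacent vertex or stays (robbers landing on the
  -- cop are captured).
  CopWins : ℕ → V → List V → Set
  CopWins zero    c rs = rs ≡ []
  CopWins (suc k) c rs =
    rs ≡ [] ⊎
    Σ V (λ c' → Adj c c' ×
      ((rs' : List V) → Pointwise Adj (remove c' rs) rs' →
         CopWins k c' (remove c' rs')))

  -- Round 0: the cop picks a start vertex, then the m robbers pick theirs;
  -- the cop can guarantee all m robbers are captured by round t.
  CaptWithin : ℕ → ℕ → Set
  CaptWithin m t = Σ V (λ c → (rs : Vec V m) → CopWins t c (remove c (toList rs)))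

IsCapt : Graph → ℕ → ℕ → Set
IsCapt G m t = CaptWithin m t × ((s : ℕ) → s < t → ¬ CaptWithin m s)
  where open Game G

data HEdge : ℕ → ℕ → Set where
  e62 : HEdge 6 2
  e21 : HEdge 2 1
  e14 : HEdge 1 4
  e56 : HEdge 5 6
  e52 : HEdge 5 2
  e51 : HEdge 5 1
  e54 : HEdge 5 4
  e36 : HEdge 3 6
  e32 : HEdge 3 2
  e31 : HEdge 3 1
  e34 : HEdge 3 4
  e76 : HEdge 7 6
  e74 : HEdge 7 4
  e73 : HEdge 7 3
  ext1 : (k : ℕ) → HEdge (8 + k) (7 + k)
  ext3 : (k : ℕ) → HEdge (8 + k) (5 + k)
  ext4 : (k : ℕ) → HEdge (8 + k) (4 + k)

-- H(n) for n ≥ 7: vertex i : Fin n carries the label toℕ i + 1 ∈ {1,…,n};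
-- adjacency is the reflexive symmetric closure of HEdge restricted to these labels.
H : ℕ → Graph
H n = record
  { V   = Fin n
  ; _≟_ = _≟ᶠ_
  ; Adj = λ u v → let a = suc (toℕ u) ; b = suc (toℕ v) in
                  a ≡ b ⊎ HEdge a b ⊎ HEdge b a
  }

{-# OPTIONS --safe #-}
-- Label the vertices of H(n) by 1, …, n.  Then u and v are adjacent exactly when |u − v| ∈ {0, 1, 3, 4} or
-- {u, v} = {1, 3}, so apart from the jump between 1 and 3 no move changes a label by 2 modulo 4.
--
-- A cop below a robber and in his residue class can keep this invariant while moving up, so from
-- vertex 1 he catches one robber within n − 4 rounds, and from anywhere within ℓ + n − 4 rounds when
-- n ≤ 4ℓ + 2 (walking down to 1 or 2 first, four labels per round).  Catching the robbers one after the other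
-- takes 2(n − 4) + ℓ rounds.
--
-- Lower bound, n = 4ℓ + 2.  The robbers move together.  They start in the residue class opposite to the cop's
-- (ahead of him if he starts at 1) and stay there until the cop uses the jump between 1 and 3; from then on they
-- run ahead of him up to n.  Cornered at n by the cop at n − 4 they split to n − 3 and n − 1, and after any cop
-- move either both regroup in a position of this kind, or one is caught and the other is in such a position:
-- the cop pays another ℓ + n − 4 rounds.
module Submission where

open import Defs
open import Data.Nat using (ℕ; zero; suc; pred; _+_; _*_; _∸_; _≤_; _<_; z≤n; s≤s; _≤?_)
open import Data.Nat using () renaming (_≟_ to _≟ℕ_)
open import Data.Nat.Properties hiding (_≟_)
open import Data.Nat.Tactic.RingSolver using (solve-∀)
open import Data.Fin using (Fin; toℕ; fromℕ<)
open import Data.Fin.Properties using (toℕ-fromℕ<; toℕ-injective; toℕ<n)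
open import Data.List using (List; []; _∷_; map; replicate; length)
open import Data.List.Properties using (filter-accept; filter-reject; filter-all; length-filter)
open import Data.List.Relation.Unary.All using (All; []; _∷_)
open import Data.List.Relation.Unary.All.Properties using () renaming (replicate⁺ to All-replicate⁺)
import Data.List.Relation.Binary.Pointwise as Pointwise
open Pointwise using (Pointwise; []; _∷_; Pointwise-length; replicate⁺)
open import Data.Vec using () renaming ([] to []ᵥ; _∷_ to _∷ᵥ_)
open import Data.Product using (Σ-syntax; _×_; _,_; proj₁; proj₂)
open import Data.Sum using (_⊎_; inj₁; inj₂; swap)
open import Data.Empty using (⊥-elim)
open import Relation.Nullary using (¬_; yes; no; ¬?)
open import Relation.Binary.PropositionalEquality using (_≡_; _≢_; refl; sym; trans; cong; subst)

module GameProperties (G : Graph) where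
  open Graph G
  open Game G

  remove-keep : ∀ {c r} rs → r ≢ c → remove c (r ∷ rs) ≡ r ∷ remove c rs
  remove-keep rs = filter-accept (λ r → ¬? (r ≟ _))

  remove-drop : ∀ {c} rs → remove c (c ∷ rs) ≡ remove c rs
  remove-drop rs = filter-reject (λ r → ¬? (r ≟ _)) (λ c≢c → c≢c refl)

  remove-fresh : ∀ {c rs} → All (_≢ c) rs → remove c rs ≡ rs
  remove-fresh {c} = filter-all (λ r → ¬? (r ≟ c))

  remove-replicate : ∀ {c r} m → r ≢ c → remove c (replicate m r) ≡ replicate m r
  remove-replicate m r≢c = remove-fresh (All-replicate⁺ m r≢c)

  copWins-[] : ∀ k c → CopWins k c []
  copWins-[] zero    c = refl
  copWins-[] (suc k) c = inj₁ refl

  copWins-suc : ∀ k {c rs} → CopWins k c rs → CopWins (suc k) c rs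
  copWins-suc zero    rs≡[]                  = inj₁ rs≡[]
  copWins-suc (suc k) (inj₁ rs≡[])           = inj₁ rs≡[]
  copWins-suc (suc k) (inj₂ (c' , c~c' , s)) = inj₂ (c' , c~c' , λ rs' p → copWins-suc k (s rs' p))

  copWins-+ : ∀ j {k c rs} → CopWins k c rs → CopWins (j + k) c rs
  copWins-+ zero    w = w
  copWins-+ (suc j) w = copWins-suc _ (copWins-+ j w)

  cop-moves : ∀ {k c a} c' → Adj c c' →
              (a ≢ c' → ∀ a' → Adj a a' → CopWins k c' (remove c' (a' ∷ []))) →
              CopWins (suc k) c (remove c (a ∷ []))
  cop-moves {k} {c} {a} c' c~c' next with a ≟ c
  ... | yes _ = inj₁ refl
  ... | no  _ = inj₂ (c' , c~c' , respond)
    where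
    respond : ∀ rs' → Pointwise Adj (remove c' (a ∷ [])) rs' → CopWins k c' (remove c' rs')
    respond rs' p with a ≟ c'
    respond []        []          | yes _   = copWins-[] k c'
    respond (a' ∷ []) (a~a' ∷ []) | no a≢c' = next a≢c' a' a~a'

  record Escape (k : ℕ) (c' : V) (rs : List V) : Set where
    constructor escape
    field
      rs'       : List V
      moves     : Pointwise Adj (remove c' rs) rs'
      cop-fails : ¬ CopWins k c' (remove c' rs')

  escape-via : ∀ {k c' rs survivors settled} rs' → Pointwise Adj survivors rs' → ¬ CopWins k c' settled →
               remove c' rs ≡ survivors → remove c' rs' ≡ settled → Escape k c' rs
  escape-via {k} {c'} rs' moves fails survive settle =
    escape rs' (subst (λ zs → Pointwise Adj zs rs') (sym survive) moves) (λ w → fails (subst (CopWins k c') settle w))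

  robbers-escape : ∀ {k c rs} → rs ≢ [] → (∀ c' → Adj c c' → Escape k c' rs) → ¬ CopWins (suc k) c rs
  robbers-escape rs≢[] flee (inj₁ rs≡[])            = rs≢[] rs≡[]
  robbers-escape rs≢[] flee (inj₂ (c' , c~c' , s)) with flee c' c~c'
  ... | escape rs' p fails = fails (s rs' p)

  AtMostOne : List V → Set
  AtMostOne rs = length rs ≤ 1

  atMostOne-remove : ∀ c rs → AtMostOne rs → AtMostOne (remove c rs)
  atMostOne-remove c rs = ≤-trans (length-filter (λ r → ¬? (r ≟ c)) rs)

  atMostOne-move : ∀ {rs rs'} → Pointwise Adj rs rs' → AtMostOne rs → AtMostOne rs'
  atMostOne-move p = subst (_≤ 1) (Pointwise-length p)

  module _ {K : ℕ} (catch-one : ∀ c b → CopWins K c (remove c (b ∷ []))) where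

    catch-atMostOne : ∀ c rs → AtMostOne rs → CopWins K c (remove c rs)
    catch-atMostOne c []          _ = copWins-[] K c
    catch-atMostOne c (b ∷ [])    _ = catch-one c b
    catch-atMostOne c (_ ∷ _ ∷ _) (s≤s ())

    catch-in-turn : ∀ k c a rs → AtMostOne rs → CopWins k c (remove c (a ∷ [])) →
                    CopWins (k + K) c (remove c (a ∷ rs))
    catch-in-turn k c a rs one w with a ≟ c
    ... | yes _ = copWins-+ k (catch-atMostOne c rs one)
    ... | no  _ = chase k w
      where
      rest : List V
      rest = remove c rs
      rest-one : AtMostOne rest
      rest-one = atMostOne-remove c rs one
      chase : ∀ k → CopWins k c (a ∷ []) → CopWins (k + K) c (a ∷ rest)
      chase (suc k) (inj₂ (c' , c~c' , s)) = inj₂ (c' , c~c' , respond)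
        where
        respond : ∀ rs' → Pointwise Adj (remove c' (a ∷ rest)) rs' → CopWins (k + K) c' (remove c' rs')
        respond rs' p with a ≟ c'
        ... | yes refl = copWins-+ k (catch-atMostOne c' rs' (atMostOne-move p (atMostOne-remove c' rest rest-one)))
        respond (a' ∷ rs'') (a~a' ∷ p) | no _ =
          catch-in-turn k c' a' rs'' (atMostOne-move p (atMostOne-remove c' rest rest-one)) (s (a' ∷ []) (a~a' ∷ []))

module Embedding (G G′ : Graph) (f : Graph.V G → Graph.V G′)
  (f-injective : ∀ {u v} → f u ≡ f v → u ≡ v)
  (adj⁺ : ∀ {u v} → Graph.Adj G u v → Graph.Adj G′ (f u) (f v))
  (adj⁻ : ∀ {u v} → Graph.Adj G′ (f u) (f v) → Graph.Adj G u v)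
  (adj-image : ∀ {u y} → Graph.Adj G′ (f u) y → Σ[ v ∈ Graph.V G ] f v ≡ y)
  where
  open Graph G
  open Graph G′ using () renaming (Adj to Adj′; _≟_ to _≟′_)
  open Game G
  open Game G′ using () renaming (remove to remove′; CopWins to CopWins′)

  map-remove : ∀ c rs → map f (remove c rs) ≡ remove′ (f c) (map f rs)
  map-remove c [] = refl
  map-remove c (r ∷ rs) with r ≟ c | f r ≟′ f c
  ... | yes _   | yes _   = map-remove c rs
  ... | yes r≡c | no  r≢c = ⊥-elim (r≢c (cong f r≡c))
  ... | no  r≢c | yes e   = ⊥-elim (r≢c (f-injective e))
  ... | no  _   | no  _   = cong (f r ∷_) (map-remove c rs)

  map≡[] : ∀ {rs} → map f rs ≡ [] → rs ≡ []
  map≡[] {[]} _ = refl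

  lift-moves : ∀ {rs ys} → Pointwise Adj′ (map f rs) ys → Σ[ rs' ∈ List V ] map f rs' ≡ ys
  lift-moves {[]}    []       = [] , refl
  lift-moves {_ ∷ _} (a ∷ as) with adj-image a | lift-moves as
  ... | v , refl | vs , refl = v ∷ vs , refl

  moves⁺ : ∀ {rs rs'} → Pointwise Adj rs rs' → Pointwise Adj′ (map f rs) (map f rs')
  moves⁺ p = Pointwise.map⁺ f f (Pointwise.map adj⁺ p)

  moves⁻ : ∀ {rs rs'} → Pointwise Adj′ (map f rs) (map f rs') → Pointwise Adj rs rs'
  moves⁻ p = Pointwise.map adj⁻ (Pointwise.map⁻ f f p)

  copWins⁺ : ∀ k c rs → CopWins k c rs → CopWins′ k (f c) (map f rs)
  copWins⁺ zero    c rs rs≡[]                 = cong (map f) rs≡[]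
  copWins⁺ (suc k) c rs (inj₁ rs≡[])          = inj₁ (cong (map f) rs≡[])
  copWins⁺ (suc k) c rs (inj₂ (c' , c~c' , s)) = inj₂ (f c' , adj⁺ c~c' , respond)
    where
    respond : ∀ ys → Pointwise Adj′ (remove′ (f c') (map f rs)) ys → CopWins′ k (f c') (remove′ (f c') ys)
    respond ys p with subst (λ zs → Pointwise Adj′ zs ys) (sym (map-remove c' rs)) p
    ... | p′ with lift-moves p′
    ...   | rs' , refl =
      subst (CopWins′ k (f c')) (map-remove c' rs') (copWins⁺ k c' (remove c' rs') (s rs' (moves⁻ p′)))

  copWins⁻ : ∀ k c rs → CopWins′ k (f c) (map f rs) → CopWins k c rs
  copWins⁻ zero    c rs e        = map≡[] e
  copWins⁻ (suc k) c rs (inj₁ e) = inj₁ (map≡[] e)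
  copWins⁻ (suc k) c rs (inj₂ (y , fc~y , s)) with adj-image fc~y
  ... | c' , refl = inj₂ (c' , adj⁻ fc~y , respond)
    where
    respond : ∀ rs' → Pointwise Adj (remove c' rs) rs' → CopWins k c' (remove c' rs')
    respond rs' p =
      copWins⁻ k c' (remove c' rs')
        (subst (CopWins′ k (f c')) (sym (map-remove c' rs'))
          (s (map f rs') (subst (λ zs → Pointwise Adj′ zs (map f rs')) (map-remove c' rs) (moves⁺ p))))

HAdj : ℕ → ℕ → Set
HAdj a b = a ≡ b ⊎ HEdge a b ⊎ HEdge b a

data Step : ℕ → ℕ → Set where
  stay   : ∀ x → Step x x
  up₁    : ∀ x → Step x (1 + x)
  up₃    : ∀ x → Step x (3 + x)
  up₄    : ∀ x → Step x (4 + x)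
  down₁  : ∀ x → Step (1 + x) x
  down₃  : ∀ x → Step (3 + x) x
  down₄  : ∀ x → Step (4 + x) x
  jump₁₃ : Step 1 3
  jump₃₁ : Step 3 1

Step-sym : ∀ {a b} → Step a b → Step b a
Step-sym (stay x)  = stay x
Step-sym (up₁ x)   = down₁ x
Step-sym (up₃ x)   = down₃ x
Step-sym (up₄ x)   = down₄ x
Step-sym (down₁ x) = up₁ x
Step-sym (down₃ x) = up₃ x
Step-sym (down₄ x) = up₄ x
Step-sym jump₁₃    = jump₃₁
Step-sym jump₃₁    = jump₁₃

Step-≤ : ∀ {c c'} → Step c c' → c' ≤ 4 + c
Step-≤ (stay c)  = m≤n+m c 4
Step-≤ (up₁ c)   = +-monoˡ-≤ c (m≤m+n 1 3)
Step-≤ (up₃ c)   = +-monoˡ-≤ c (m≤m+n 3 1)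
Step-≤ (up₄ c)   = ≤-refl
Step-≤ (down₁ c) = m≤n+m c 5
Step-≤ (down₃ c) = m≤n+m c 7
Step-≤ (down₄ c) = m≤n+m c 8
Step-≤ jump₁₃    = m≤m+n 3 2
Step-≤ jump₃₁    = m≤m+n 1 6

HEdge⇒Step : ∀ {a b} → HEdge a b → Step a b
HEdge⇒Step e62      = down₄ 2
HEdge⇒Step e21      = down₁ 1
HEdge⇒Step e14      = up₃ 1
HEdge⇒Step e56      = up₁ 5
HEdge⇒Step e52      = down₃ 2
HEdge⇒Step e51      = down₄ 1
HEdge⇒Step e54      = down₁ 4
HEdge⇒Step e36      = up₃ 3
HEdge⇒Step e32      = down₁ 2
HEdge⇒Step e31      = jump₃₁
HEdge⇒Step e34      = up₁ 3
HEdge⇒Step e76      = down₁ 6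
HEdge⇒Step e74      = down₃ 4
HEdge⇒Step e73      = down₄ 3
HEdge⇒Step (ext1 k) = down₁ (7 + k)
HEdge⇒Step (ext3 k) = down₃ (5 + k)
HEdge⇒Step (ext4 k) = down₄ (4 + k)

HAdj⇒Step : ∀ {a b} → HAdj a b → Step a b
HAdj⇒Step (inj₁ refl)      = stay _
HAdj⇒Step (inj₂ (inj₁ e)) = HEdge⇒Step e
HAdj⇒Step (inj₂ (inj₂ e)) = Step-sym (HEdge⇒Step e)

HEdge-down₁ : ∀ y → HEdge (2 + y) (1 + y) ⊎ HEdge (1 + y) (2 + y)
HEdge-down₁ 0 = inj₁ e21
HEdge-down₁ 1 = inj₁ e32
HEdge-down₁ 2 = inj₂ e34
HEdge-down₁ 3 = inj₁ e54
HEdge-down₁ 4 = inj₂ e56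
HEdge-down₁ 5 = inj₁ e76
HEdge-down₁ (suc (suc (suc (suc (suc (suc k)))))) = inj₁ (ext1 k)

HEdge-down₃ : ∀ y → HEdge (4 + y) (1 + y) ⊎ HEdge (1 + y) (4 + y)
HEdge-down₃ 0 = inj₂ e14
HEdge-down₃ 1 = inj₁ e52
HEdge-down₃ 2 = inj₂ e36
HEdge-down₃ 3 = inj₁ e74
HEdge-down₃ (suc (suc (suc (suc k)))) = inj₁ (ext3 k)

HEdge-down₄ : ∀ y → HEdge (5 + y) (1 + y) ⊎ HEdge (1 + y) (5 + y)
HEdge-down₄ 0 = inj₁ e51
HEdge-down₄ 1 = inj₁ e62
HEdge-down₄ 2 = inj₁ e73
HEdge-down₄ (suc (suc (suc k))) = inj₁ (ext4 k)

Step⇒HAdj : ∀ {a b} → Step (suc a) (suc b) → HAdj (suc a) (suc b)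
Step⇒HAdj (stay _)        = inj₁ refl
Step⇒HAdj (up₁ (suc y))   = inj₂ (swap (HEdge-down₁ y))
Step⇒HAdj (up₃ (suc y))   = inj₂ (swap (HEdge-down₃ y))
Step⇒HAdj (up₄ (suc y))   = inj₂ (swap (HEdge-down₄ y))
Step⇒HAdj (down₁ (suc y)) = inj₂ (HEdge-down₁ y)
Step⇒HAdj (down₃ (suc y)) = inj₂ (HEdge-down₃ y)
Step⇒HAdj (down₄ (suc y)) = inj₂ (HEdge-down₄ y)
Step⇒HAdj jump₁₃          = inj₂ (inj₂ e31)
Step⇒HAdj jump₃₁          = inj₂ (inj₁ e31)

IsVertex : ℕ → ℕ → Set
IsVertex n x = 1 ≤ x × x ≤ n

-- H(n) on the labels themselves.  The other naturals are unreachable vertices: a move must land in range.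
Hℕ : ℕ → Graph
Hℕ n = record { V = ℕ ; _≟_ = _≟ℕ_ ; Adj = λ a b → Step a b × IsVertex n b }

module Labelling (n : ℕ) where
  label : Fin n → ℕ
  label i = suc (toℕ i)

  label-injective : ∀ {u v} → label u ≡ label v → u ≡ v
  label-injective e = toℕ-injective (suc-injective e)

  label-isVertex : ∀ i → IsVertex n (label i)
  label-isVertex i = s≤s z≤n , toℕ<n i

  vertex-label : ∀ {x} → IsVertex n x → Σ[ i ∈ Fin n ] label i ≡ x
  vertex-label {suc x} (_ , x<n) = fromℕ< x<n , cong suc (toℕ-fromℕ< x<n)

  open Embedding (H n) (Hℕ n) label label-injective
         (λ {_} {v} a → HAdj⇒Step a , label-isVertex v)
         (λ (s , _) → Step⇒HAdj s)
         (λ (_ , y-vertex) → vertex-label y-vertex)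
    public

data Residue : Set where
  0₄ 1₄ 2₄ 3₄ : Residue

next : Residue → Residue
next 0₄ = 1₄
next 1₄ = 2₄
next 2₄ = 3₄
next 3₄ = 0₄

next-injective : ∀ {ρ σ} → next ρ ≡ next σ → ρ ≡ σ
next-injective {0₄} {0₄} _ = refl
next-injective {1₄} {1₄} _ = refl
next-injective {2₄} {2₄} _ = refl
next-injective {3₄} {3₄} _ = refl

residue : ℕ → Residue
residue 0 = 0₄
residue 1 = 1₄
residue 2 = 2₄
residue 3 = 3₄
residue (suc (suc (suc (suc x)))) = residue x

residue-suc : ∀ x → residue (suc x) ≡ next (residue x)
residue-suc 0 = refl
residue-suc 1 = refl
residue-suc 2 = refl
residue-suc 3 = refl
residue-suc (suc (suc (suc (suc x)))) = residue-suc x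

infix 4 _≡₄_

-- A record rather than a bare equation of residues, so that a and b stay inferable.
record _≡₄_ (a b : ℕ) : Set where
  constructor mod4
  field residue≡ : residue a ≡ residue b

≡₄-sym : ∀ {a b} → a ≡₄ b → b ≡₄ a
≡₄-sym (mod4 e) = mod4 (sym e)

≡₄-trans : ∀ {a b c} → a ≡₄ b → b ≡₄ c → a ≡₄ c
≡₄-trans (mod4 e) (mod4 e') = mod4 (trans e e')

≡₄-suc : ∀ {a b} → a ≡₄ b → suc a ≡₄ suc b
≡₄-suc {a} {b} (mod4 e) = mod4 (trans (residue-suc a) (trans (cong next e) (sym (residue-suc b))))

≡₄-pred : ∀ {a b} → suc a ≡₄ suc b → a ≡₄ b
≡₄-pred {a} {b} (mod4 e) = mod4 (next-injective (trans (sym (residue-suc a)) (trans e (residue-suc b))))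

≡₄-+ : ∀ d {a b} → a ≡₄ b → d + a ≡₄ d + b
≡₄-+ zero    e = e
≡₄-+ (suc d) e = ≡₄-suc (≡₄-+ d e)

≡₄-4+ˡ : ∀ {a b} → 4 + a ≡₄ b → a ≡₄ b
≡₄-4+ˡ (mod4 e) = mod4 e

≡₄-4+ʳ : ∀ {a b} → a ≡₄ 4 + b → a ≡₄ b
≡₄-4+ʳ (mod4 e) = mod4 e

≡₄-+4ʳ : ∀ {a b} → a ≡₄ b → a ≡₄ 4 + b
≡₄-+4ʳ (mod4 e) = mod4 e

≡₄-gap : ∀ {a b} → a ≡₄ b → b ≤ a → a ≡ b ⊎ 4 + b ≤ a
≡₄-gap {zero}                    {zero} _ _ = inj₁ refl
≡₄-gap {suc zero}                {zero} (mod4 ())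
≡₄-gap {suc (suc zero)}          {zero} (mod4 ())
≡₄-gap {suc (suc (suc zero))}    {zero} (mod4 ())
≡₄-gap {suc (suc (suc (suc a)))} {zero} _ _ = inj₂ (s≤s (s≤s (s≤s (s≤s z≤n))))
≡₄-gap {suc a} {suc b} e (s≤s b≤a) with ≡₄-gap (≡₄-pred e) b≤a
... | inj₁ refl = inj₁ refl
... | inj₂ gap  = inj₂ (subst (_≤ suc a) (sym (+-suc 4 b)) (s≤s gap))

≡₄-lower : ∀ {r j} → j < 4 → r ≡₄ j → j ≤ r
≡₄-lower {r}                 {0} _ _ = z≤n
≡₄-lower {0}                 {1} _ (mod4 ())
≡₄-lower {suc r}             {1} _ _ = s≤s z≤n
≡₄-lower {0}                 {2} _ (mod4 ())
≡₄-lower {1}                 {2} _ (mod4 ())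
≡₄-lower {suc (suc r)}       {2} _ _ = s≤s (s≤s z≤n)
≡₄-lower {0}                 {3} _ (mod4 ())
≡₄-lower {1}                 {3} _ (mod4 ())
≡₄-lower {2}                 {3} _ (mod4 ())
≡₄-lower {suc (suc (suc r))} {3} _ _ = s≤s (s≤s (s≤s z≤n))
≡₄-lower {_} {suc (suc (suc (suc _)))} (s≤s (s≤s (s≤s (s≤s ()))))

≡₄-above : ∀ {r j} → j < 4 → r ≡₄ j → r ≢ j → 4 + j ≤ r
≡₄-above j<4 r≡j r≢j with ≡₄-gap r≡j (≡₄-lower j<4 r≡j)
... | inj₁ r≡j' = ⊥-elim (r≢j r≡j')
... | inj₂ gap  = gap

≢₄-+ : ∀ d x → 1 ≤ d → d ≤ 3 → ¬ x ≡₄ d + x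
≢₄-+ 1 zero _ _ (mod4 ())
≢₄-+ 2 zero _ _ (mod4 ())
≢₄-+ 3 zero _ _ (mod4 ())
≢₄-+ (suc (suc (suc (suc _)))) zero _ (s≤s (s≤s (s≤s ())))
≢₄-+ d (suc x) 1≤d d≤3 e = ≢₄-+ d x 1≤d d≤3 (≡₄-pred (subst (suc x ≡₄_) (+-suc d x) e))

residue-cases : ∀ a → a ≡₄ 0 ⊎ a ≡₄ 1 ⊎ a ≡₄ 2 ⊎ a ≡₄ 3
residue-cases a with residue a in e
... | 0₄ = inj₁ (mod4 e)
... | 1₄ = inj₂ (inj₁ (mod4 e))
... | 2₄ = inj₂ (inj₂ (inj₁ (mod4 e)))
... | 3₄ = inj₂ (inj₂ (inj₂ (mod4 e)))

Step-residue : ∀ {a a'} → Step a a' → 4 ≤ a → a' ≡₄ a ⊎ a' ≡₄ 1 + a ⊎ a' ≡₄ 3 + a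
Step-residue (stay _)  _ = inj₁ (mod4 refl)
Step-residue (up₁ _)   _ = inj₂ (inj₁ (mod4 refl))
Step-residue (up₃ _)   _ = inj₂ (inj₂ (mod4 refl))
Step-residue (up₄ _)   _ = inj₁ (mod4 refl)
Step-residue (down₁ _) _ = inj₂ (inj₂ (mod4 refl))
Step-residue (down₃ _) _ = inj₂ (inj₁ (mod4 refl))
Step-residue (down₄ _) _ = inj₁ (mod4 refl)
Step-residue jump₁₃    (s≤s ())
Step-residue jump₃₁    (s≤s (s≤s (s≤s ())))

module Pursuit (n : ℕ) where
  open Graph (Hℕ n) using (Adj)
  open Game (Hℕ n)
  open GameProperties (Hℕ n)

  caught : ∀ k c → CopWins k c (remove c (c ∷ []))
  caught k c = subst (CopWins k c) (sym (remove-drop {c} [])) (copWins-[] k c)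

  capture : ∀ {k c a} → Step c a → IsVertex n a → CopWins (suc k) c (remove c (a ∷ []))
  capture s a-vertex = cop-moves _ (s , a-vertex) (λ a≢a → ⊥-elim (a≢a refl))

  bound-shift : ∀ {k c} d → 1 ≤ d → n ≤ suc k + (3 + c) → n ≤ k + (3 + (d + c))
  bound-shift {k} {c} d 1≤d bound =
    ≤-trans bound (≤-trans (≤-reflexive (sym (+-suc k (3 + c)))) (+-monoʳ-≤ k (+-monoʳ-≤ 3 (+-monoˡ-≤ c 1≤d))))

  ahead : ∀ {c a} d → 4 + c ≤ a → d + c ≤ d + a
  ahead {c} d gap = +-monoʳ-≤ d (≤-trans (m≤n+m c 4) gap)

  -- The cop stays below the robber in the robber's residue class: he answers each robber move by the move
  -- of length 1, 3 or 4 that restores this, so he only ever moves up.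
  mutual
    pursue : ∀ k {c c' a} → Step c c' → 1 ≤ c' → a ≡₄ c' → c' ≤ a → IsVertex n a → n ≤ k + (3 + c') →
             CopWins (suc k) c (remove c (a ∷ []))
    pursue k s 1≤c' a≡c' c'≤a a-vertex bound with ≡₄-gap a≡c' c'≤a
    ... | inj₁ refl = capture s a-vertex
    ... | inj₂ gap  = cop-moves _ (s , 1≤c' , ≤-trans c'≤a (proj₂ a-vertex))
                        (λ _ a' a~a' → shadow k 1≤c' a≡c' gap (proj₂ a-vertex) bound a~a')

    shadow : ∀ k {c a a'} → 1 ≤ c → a ≡₄ c → 4 + c ≤ a → a ≤ n → n ≤ k + (3 + c) → Adj a a' →
             CopWins k c (remove c (a' ∷ []))
    shadow zero _ _ gap a≤n bound _ = ⊥-elim (<-irrefl refl (≤-trans (≤-trans gap a≤n) bound))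
    shadow (suc k) {c} _ a≡c gap _ bound (stay a , a'-vertex) =
      pursue k (up₄ c) (s≤s z≤n) (≡₄-+4ʳ a≡c) gap a'-vertex (bound-shift 4 (s≤s z≤n) bound)
    shadow (suc k) {c} _ a≡c gap _ bound (up₁ a , a'-vertex) =
      pursue k (up₁ c) (s≤s z≤n) (≡₄-+ 1 a≡c) (ahead 1 gap) a'-vertex (bound-shift 1 (s≤s z≤n) bound)
    shadow (suc k) {c} _ a≡c gap _ bound (up₃ a , a'-vertex) =
      pursue k (up₃ c) (s≤s z≤n) (≡₄-+ 3 a≡c) (ahead 3 gap) a'-vertex (bound-shift 3 (s≤s z≤n) bound)
    shadow (suc k) {c} _ a≡c gap _ bound (up₄ a , a'-vertex) =
      pursue k (up₄ c) (s≤s z≤n) (≡₄-+ 4 a≡c) (ahead 4 gap) a'-vertex (bound-shift 4 (s≤s z≤n) bound)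
    shadow (suc k) {c} _ a≡c (s≤s gap) _ bound (down₁ x , a'-vertex) =
      pursue k (up₃ c) (s≤s z≤n) (≡₄-pred (≡₄-+4ʳ a≡c)) gap a'-vertex (bound-shift 3 (s≤s z≤n) bound)
    shadow (suc k) {c} _ a≡c (s≤s (s≤s (s≤s gap))) _ bound (down₃ x , a'-vertex) =
      pursue k (up₁ c) (s≤s z≤n) (≡₄-pred (≡₄-pred (≡₄-pred (≡₄-+4ʳ a≡c)))) gap a'-vertex (bound-shift 1 (s≤s z≤n) bound)
    shadow (suc k) {c} _ a≡c (s≤s (s≤s (s≤s (s≤s gap)))) _ bound (down₄ x , a'-vertex)
      with ≡₄-gap (≡₄-4+ˡ a≡c) gap
    ... | inj₁ refl = caught (suc k) c
    ... | inj₂ gap' = pursue k (up₄ c) (s≤s z≤n) (≡₄-+4ʳ (≡₄-4+ˡ a≡c)) gap' a'-vertex (bound-shift 4 (s≤s z≤n) bound)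
    shadow (suc k) _ _ (s≤s ()) _ _ (jump₁₃ , _)
    shadow (suc k) _ _ (s≤s (s≤s (s≤s ()))) _ _ (jump₃₁ , _)

  slack : ∀ k j d → n ≤ k + 6 → n ≤ (j + k) + (6 + d)
  slack k j d bound = ≤-trans bound (+-mono-≤ (m≤n+m k j) (m≤m+n 6 d))

  catch-from-1-by-residue : ∀ k a → IsVertex n a → n ≤ k + 6 → (a ≡₄ 2 → n ≤ k + 5) →
                            CopWins (suc k) 1 (remove 1 (a ∷ []))
  catch-from-1-by-residue k a a-vertex@(1≤a , _) bound bound₂ with residue-cases a
  ... | inj₁ a≡0 =
    pursue k (up₃ 1) (s≤s z≤n) (≡₄-+4ʳ a≡0) (≡₄-above (s≤s z≤n) a≡0 (m<n⇒n≢0 1≤a)) a-vertex (slack k 0 1 bound)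
  ... | inj₂ (inj₁ a≡1) with ≡₄-gap a≡1 1≤a
  ...   | inj₁ refl = caught (suc k) 1
  ...   | inj₂ 5≤a  = pursue k (up₄ 1) (s≤s z≤n) (≡₄-+4ʳ a≡1) 5≤a a-vertex (slack k 0 2 bound)
  catch-from-1-by-residue k a a-vertex bound bound₂ | inj₂ (inj₂ (inj₁ a≡2)) =
    pursue k (up₁ 1) (s≤s z≤n) a≡2 (≡₄-lower (s≤s (s≤s (s≤s z≤n))) a≡2) a-vertex (bound₂ a≡2)
  catch-from-1-by-residue k a a-vertex bound bound₂ | inj₂ (inj₂ (inj₂ a≡3)) =
    pursue k jump₁₃ (s≤s z≤n) a≡3 (≡₄-lower ≤-refl a≡3) a-vertex bound

  catch-from-1 : ∀ k a → IsVertex n a → n ≤ k + 6 → CopWins (2 + k) 1 (remove 1 (a ∷ []))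
  catch-from-1 k a a-vertex bound =
    catch-from-1-by-residue (suc k) a a-vertex (slack k 1 0 bound) (λ _ → subst (n ≤_) (+-suc k 5) bound)

  catch-from-2 : ∀ k a → IsVertex n a → n ≤ k + 6 → CopWins (2 + k) 2 (remove 2 (a ∷ []))
  catch-from-2 k a a-vertex@(1≤a , a≤n) bound with residue-cases a
  ... | inj₁ a≡0 =
    cop-moves 1 (down₁ 1 , s≤s z≤n , ≤-trans 1≤a a≤n)
      (λ _ a' (s , a'-vertex) → catch-from-1-by-residue k a' a'-vertex bound (λ a'≡2 → ⊥-elim (off-2 s a'≡2)))
    where
    off-2 : ∀ {a'} → Step a a' → ¬ a' ≡₄ 2
    off-2 s a'≡2 with Step-residue s (≡₄-above (s≤s z≤n) a≡0 (m<n⇒n≢0 1≤a))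
    ... | inj₁ a'≡a with ≡₄-trans (≡₄-sym a'≡2) (≡₄-trans a'≡a a≡0)
    ...   | mod4 ()
    off-2 s a'≡2 | inj₂ (inj₁ a'≡1+a) with ≡₄-trans (≡₄-sym a'≡2) (≡₄-trans a'≡1+a (≡₄-+ 1 a≡0))
    ...   | mod4 ()
    off-2 s a'≡2 | inj₂ (inj₂ a'≡3+a) with ≡₄-trans (≡₄-sym a'≡2) (≡₄-trans a'≡3+a (≡₄-+ 3 a≡0))
    ...   | mod4 ()
  ... | inj₂ (inj₁ a≡1) with ≡₄-gap a≡1 1≤a
  ...   | inj₁ refl = capture (down₁ 1) a-vertex
  ...   | inj₂ 5≤a  = pursue (suc k) (up₃ 2) (s≤s z≤n) (≡₄-+4ʳ a≡1) 5≤a a-vertex (slack k 1 2 bound)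
  catch-from-2 k a a-vertex@(1≤a , _) bound | inj₂ (inj₂ (inj₁ a≡2))
    with ≡₄-gap a≡2 (≡₄-lower (s≤s (s≤s (s≤s z≤n))) a≡2)
  ... | inj₁ refl = caught (2 + k) 2
  ... | inj₂ 6≤a  = pursue (suc k) (up₄ 2) (s≤s z≤n) (≡₄-+4ʳ a≡2) 6≤a a-vertex (slack k 1 3 bound)
  catch-from-2 k a a-vertex bound | inj₂ (inj₂ (inj₂ a≡3)) =
    pursue (suc k) (up₁ 2) (s≤s z≤n) a≡3 (≡₄-lower ≤-refl a≡3) a-vertex (slack k 1 0 bound)

  catch-descending : ∀ q k c a → IsVertex n c → c ≤ 2 + q * 4 → IsVertex n a → n ≤ k + 6 →
                     CopWins (q + (2 + k)) c (remove c (a ∷ []))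
  catch-descending q k 1 a _ _ a-vertex bound = copWins-+ q (catch-from-1 k a a-vertex bound)
  catch-descending q k 2 a _ _ a-vertex bound = copWins-+ q (catch-from-2 k a a-vertex bound)
  catch-descending (suc q) k 3 a (_ , 3≤n) _ _ bound =
    cop-moves {a = a} 1 (jump₃₁ , s≤s z≤n , ≤-trans (s≤s z≤n) 3≤n)
      (λ _ a' (_ , a'-vertex) → catch-descending q k 1 a' (s≤s z≤n , ≤-trans (s≤s z≤n) 3≤n) (s≤s z≤n) a'-vertex bound)
  catch-descending (suc q) k 4 a (_ , 4≤n) _ _ bound =
    cop-moves {a = a} 1 (down₃ 1 , s≤s z≤n , ≤-trans (s≤s z≤n) 4≤n)
      (λ _ a' (_ , a'-vertex) → catch-descending q k 1 a' (s≤s z≤n , ≤-trans (s≤s z≤n) 4≤n) (s≤s z≤n) a'-vertex bound)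
  catch-descending (suc q) k (suc (suc (suc (suc (suc c))))) a (_ , c≤n) (s≤s (s≤s (s≤s (s≤s c≤q)))) _ bound =
    cop-moves {a = a} (suc c) (down₄ (suc c) , c'-vertex)
      (λ _ a' (_ , a'-vertex) → catch-descending q k (suc c) a' c'-vertex c≤q a'-vertex bound)
    where
    c'-vertex : IsVertex n (suc c)
    c'-vertex = s≤s z≤n , ≤-trans (m≤n+m (suc c) 4) c≤n
  catch-descending zero k (suc (suc (suc _))) _ _ (s≤s (s≤s ())) _ _

  catch-anywhere : ∀ q k → n ≤ 2 + q * 4 → n ≤ k + 6 →
                   ∀ c a → IsVertex n c → IsVertex n a → CopWins (q + (2 + k)) c (remove c (a ∷ []))
  catch-anywhere q k n≤ bound c a c-vertex a-vertex =
    catch-descending q k c a c-vertex (≤-trans (proj₂ c-vertex) n≤) a-vertex bound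

module UpperBound (n : ℕ) where
  open Game (H n)
  open GameProperties (H n)
  open Labelling n
  open Pursuit n using (catch-from-1; catch-anywhere)
  module Gℕ = Game (Hℕ n)

  copWins-from-labels : ∀ k c a → Gℕ.CopWins k (label c) (Gℕ.remove (label c) (label a ∷ [])) →
                        CopWins k c (remove c (a ∷ []))
  copWins-from-labels k c a w =
    copWins⁻ k c (remove c (a ∷ [])) (subst (Gℕ.CopWins k (label c)) (sym (map-remove c (a ∷ []))) w)

  captWithin : ∀ q k → 1 ≤ n → n ≤ 2 + q * 4 → n ≤ k + 6 → CaptWithin 2 ((2 + k) + (q + (2 + k)))
  captWithin q k 1≤n n≤ bound with vertex-label (≤-refl , 1≤n)
  ... | c , label-c≡1 =
    c , λ { (x ∷ᵥ y ∷ᵥ []ᵥ) → catch-in-turn catch-one (2 + k) c x (y ∷ []) (s≤s z≤n) (catch-first x) }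
    where
    catch-one : ∀ c b → CopWins (q + (2 + k)) c (remove c (b ∷ []))
    catch-one c b =
      copWins-from-labels _ c b (catch-anywhere q k n≤ bound (label c) (label b) (label-isVertex c) (label-isVertex b))
    catch-first : ∀ a → CopWins (2 + k) c (remove c (a ∷ []))
    catch-first a = copWins-from-labels _ c a
      (subst (λ v → Gℕ.CopWins (2 + k) v (Gℕ.remove v (label a ∷ []))) (sym label-c≡1)
        (catch-from-1 k (label a) (label-isVertex a) bound))

K+5≡ : ∀ t → ((2 + t) + (6 + t * 4)) + 5 ≡ (10 + t * 4) + ((3 + t) + 0)
K+5≡ = solve-∀

T+4≡ : ∀ t → ((6 + t * 4) + ((2 + t) + (6 + t * 4))) + 4 ≡ (10 + t * 4) + ((2 + t) + (6 + t * 4))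
T+4≡ = solve-∀

-- Here ℓ = t + 2, so N = 4ℓ + 2, K = ℓ + (N − 4) and T = (N − 4) + K.
module LowerBound (t : ℕ) where
  N N-1 N-2 N-3 N-4 : ℕ
  N   = 10 + t * 4
  N-1 = 9 + t * 4
  N-2 = 8 + t * 4
  N-3 = 7 + t * 4
  N-4 = 6 + t * 4

  open Graph (Hℕ N) using (Adj)
  open Game (Hℕ N)
  open GameProperties (Hℕ N)

  Vertex : ℕ → Set
  Vertex = IsVertex N

  small-vertex : ∀ {x} → 1 ≤ x → x ≤ 10 → Vertex x
  small-vertex 1≤x x≤10 = 1≤x , ≤-trans x≤10 (m≤m+n 10 (t * 4))

  top-vertex : ∀ {j} → 1 ≤ j → j ≤ 10 → Vertex (j + t * 4)
  top-vertex {j} 1≤j j≤10 = ≤-trans 1≤j (m≤m+n j (t * 4)) , +-monoˡ-≤ (t * 4) j≤10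

  top-≢ : ∀ i j → i ≢ j → i + t * 4 ≢ j + t * 4
  top-≢ i j i≢j e = i≢j (+-cancelʳ-≡ (t * 4) i j e)

  N≡₄2 : N ≡₄ 2
  N≡₄2 = mod4 (residue-2+t*4 t)
    where
    residue-2+t*4 : ∀ t → residue (2 + t * 4) ≡ 2₄
    residue-2+t*4 zero    = refl
    residue-2+t*4 (suc t) = residue-2+t*4 t

  Advanced : ℕ → ℕ → Set
  Advanced r r' = r' ≡ 1 + r ⊎ (r ≡ N × r' ≡ N-3)

  data Advance (r : ℕ) : Set where
    advance : ∀ r' → Step r r' → Vertex r' → r' ≡₄ 1 + r → Advanced r r' → Advance r

  advance-from : ∀ r → Vertex r → Advance r
  advance-from r (1≤r , r≤N) with r ≟ℕ N
  ... | yes refl = advance N-3 (down₃ N-3) (top-vertex (s≤s z≤n) (m≤m+n 7 3)) (mod4 refl) (inj₂ (refl , refl))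
  ... | no  r≢N  = advance (1 + r) (up₁ r) (s≤s z≤n , ≤∧≢⇒< r≤N r≢N) (mod4 refl) (inj₁ refl)

  advanced-≥ : ∀ {j r r'} → j ≤ 6 → j ≤ r → Advanced r r' → 1 + j ≤ r'
  advanced-≥ _   j≤r (inj₁ refl)       = s≤s j≤r
  advanced-≥ j≤6 _   (inj₂ (_ , refl)) = ≤-trans (s≤s j≤6) (m≤m+n 7 (t * 4))

  advanced-≤ : ∀ {r r'} → Advanced r r' → r ≤ 3 + r'
  advanced-≤ {r} (inj₁ refl)          = m≤n+m r 4
  advanced-≤     (inj₂ (refl , refl)) = ≤-refl

  data Retreat (r : ℕ) : Set where
    retreat : ∀ r' → Step r r' → Vertex r' → r' ≡₄ 3 + r → (∀ {j} → 1 + j ≤ r → j ≤ r') → Retreat r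

  retreat-from : ∀ r → Vertex r → Retreat r
  retreat-from 1 _ = retreat 4 (up₃ 1) (small-vertex (s≤s z≤n) (m≤m+n 4 6)) (mod4 refl) (λ { (s≤s z≤n) → z≤n })
  retreat-from (suc (suc r)) (_ , r≤N) =
    retreat (suc r) (down₁ (suc r)) (s≤s z≤n , ≤-trans (n≤1+n _) r≤N) (mod4 refl) ≤-pred

  -- Positions from which the robbers, together on r, survive k more rounds against the cop on c.  They either
  -- run ahead of him in the next residue class (chase) or sit in the opposite one (at-one, opposite), where the
  -- cop needs q ≤ (5 + c)/4 extra rounds to walk down to the jump 1–3.  B extra rounds are gained when the
  -- robbers are cornered at N.
  data Position (B k : ℕ) : ℕ → ℕ → Set where
    chase    : ∀ {c r} → 5 + c ≤ r → r ≡₄ 1 + c → k + (4 + c) ≤ N + B → Position B k c r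
    at-one   : ∀ {r} → r ≡₄ 3 → 4 ≤ r → k + 6 ≤ N + B → Position B k 1 r
    opposite : ∀ {c r} → 2 ≤ c → r ≡₄ 2 + c → (c ≤ 3 → 4 ≤ r) → (q : ℕ) → q * 4 ≤ 5 + c →
               k + 6 ≤ N + (q + B) → Position B k c r

  not-adjacent : ∀ {B k c c' r} → Position B k c r → Step c c' → r ≢ c'
  not-adjacent (chase 5+c≤r _ _) s refl = <-irrefl refl (≤-trans 5+c≤r (Step-≤ s))
  not-adjacent (at-one (mod4 ()) _ _) (stay _)  refl
  not-adjacent (at-one (mod4 ()) _ _) (up₁ _)   refl
  not-adjacent (at-one (mod4 ()) _ _) (up₃ _)   refl
  not-adjacent (at-one (mod4 ()) _ _) (up₄ _)   refl
  not-adjacent (at-one (mod4 ()) _ _) (down₁ _) refl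
  not-adjacent (at-one _ (s≤s (s≤s (s≤s ()))) _) jump₁₃ refl
  not-adjacent (opposite _ r≡ _ _ _ _) (stay c)  refl = ≢₄-+ 2 c (s≤s z≤n) (m≤m+n 2 1) r≡
  not-adjacent (opposite _ r≡ _ _ _ _) (up₁ c)   refl = ≢₄-+ 1 c ≤-refl (m≤m+n 1 2) (≡₄-pred r≡)
  not-adjacent (opposite _ r≡ _ _ _ _) (up₃ c)   refl = ≢₄-+ 1 c ≤-refl (m≤m+n 1 2) (≡₄-sym (≡₄-pred (≡₄-pred r≡)))
  not-adjacent (opposite _ r≡ _ _ _ _) (up₄ c)   refl = ≢₄-+ 2 c (s≤s z≤n) (m≤m+n 2 1) (≡₄-4+ˡ r≡)
  not-adjacent (opposite _ r≡ _ _ _ _) (down₁ c) refl = ≢₄-+ 3 c (s≤s z≤n) ≤-refl r≡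
  not-adjacent (opposite _ r≡ _ _ _ _) (down₃ c) refl = ≢₄-+ 1 c ≤-refl (m≤m+n 1 2) (≡₄-4+ʳ r≡)
  not-adjacent (opposite _ r≡ _ _ _ _) (down₄ c) refl = ≢₄-+ 2 c (s≤s z≤n) (m≤m+n 2 1) (≡₄-4+ʳ r≡)
  not-adjacent (opposite (s≤s ()) _ _ _ _ _) jump₁₃ refl
  not-adjacent (opposite _ _ 4≤r _ _ _) jump₃₁ refl with 4≤r (s≤s (s≤s (s≤s z≤n)))
  ... | s≤s ()

  apart : ∀ {B k c r} → Position B k c r → r ≢ c
  apart {c = c} p = not-adjacent p (stay c)

  spend : ∀ k x {x' Y} → suc k + x ≤ Y → x' ≤ suc x → k + x' ≤ Y
  spend k x b x'≤ = ≤-trans (+-monoʳ-≤ k x'≤) (≤-trans (≤-reflexive (+-suc k x)) b)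

  spend-q : ∀ k q B → suc k + 6 ≤ N + (q + B) → k + 6 ≤ N + (pred q + B)
  spend-q k zero    B b = ≤-trans (n≤1+n _) b
  spend-q k (suc q) B b = ≤-pred (≤-trans b (≤-reflexive (+-suc N (q + B))))

  spend-q≤1 : ∀ k q B → q * 4 ≤ 7 → suc k + 6 ≤ N + (q + B) → k + 6 ≤ N + B
  spend-q≤1 k zero          B _ b = spend-q k zero B b
  spend-q≤1 k (suc zero)    B _ b = spend-q k 1 B b
  spend-q≤1 k (suc (suc q)) B (s≤s (s≤s (s≤s (s≤s (s≤s (s≤s (s≤s ()))))))) b

  spend-q≤2 : ∀ k q B → q * 4 ≤ 10 → suc k + 6 ≤ N + (q + B) → k + 5 ≤ N + B
  spend-q≤2 k zero             B _ b = ≤-trans (+-mono-≤ (n≤1+n k) (n≤1+n 5)) b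
  spend-q≤2 k (suc zero)       B _ b = ≤-trans (+-monoʳ-≤ k (n≤1+n 5)) (spend-q k 1 B b)
  spend-q≤2 k (suc (suc zero)) B _ b =
    ≤-pred (≤-trans (≤-reflexive (sym (+-suc k 5))) (≤-trans (spend-q k 2 B b) (≤-reflexive (+-suc N B))))
  spend-q≤2 k (suc (suc (suc q))) B (s≤s (s≤s (s≤s (s≤s (s≤s (s≤s (s≤s (s≤s (s≤s (s≤s ())))))))))) b

  q-shift : ∀ q c c' → q * 4 ≤ 5 + c → c ≤ 4 + c' → pred q * 4 ≤ 5 + c'
  q-shift zero    _ _ _  _  = z≤n
  q-shift (suc q) c c' q≤ c≤ = +-cancelˡ-≤ 4 _ _ (≤-trans q≤ (+-monoʳ-≤ 5 c≤))

  opposite₀ : ∀ {B k c' r'} → 1 ≤ c' → r' ≡₄ 2 + c' → (c' ≤ 3 → 4 ≤ r') → k + 6 ≤ N + B → Position B k c' r'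
  opposite₀ {c' = 1}           _ r'≡ 4≤r' b = at-one r'≡ (4≤r' (s≤s z≤n)) b
  opposite₀ {c' = suc (suc _)} _ r'≡ 4≤r' b = opposite (s≤s (s≤s z≤n)) r'≡ 4≤r' 0 z≤n b

  opposite-next : ∀ {B k c c' r'} q → 2 ≤ c' → r' ≡₄ 2 + c' → (c' ≤ 3 → 4 ≤ r') → q * 4 ≤ 5 + c → c ≤ 4 + c' →
                  suc k + 6 ≤ N + (q + B) → Position B k c' r'
  opposite-next {B} {k} {c} {c'} q 2≤c' r'≡ 4≤r' q≤ c≤ bd =
    opposite 2≤c' r'≡ 4≤r' (pred q) (q-shift q c c' q≤ c≤) (spend-q k q B bd)

  beyond-3 : ∀ {c r} → 4 ≤ c → c ≤ 3 → 4 ≤ r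
  beyond-3 4≤c c≤3 = ⊥-elim (<⇒≱ 4≤c c≤3)

  data Reply (B k c' r : ℕ) : Set where
    reply : ∀ {r'} → Step r r' → Vertex r' → Position B k c' r' → Reply B k c' r

  Cornered : ℕ → ℕ → ℕ → ℕ → Set
  Cornered B k c' r = r ≡ N × c' ≡ N-4 × k ≤ B

  cornered : ∀ {B k} c → N ≡ 5 + c → suc k + (4 + c) ≤ N + B → Cornered B k (1 + c) N
  cornered {B} {k} c N≡5+c bd with cong (_∸ 5) N≡5+c
  ... | refl =
    refl , refl , +-cancelʳ-≤ N k B (≤-trans (≤-reflexive (+-suc k (9 + t * 4))) (≤-trans bd (≤-reflexive (+-comm N B))))

  chase-follow : ∀ {B k c r} → Vertex r → 5 + c ≤ r → r ≡₄ 1 + c → suc k + (4 + c) ≤ N + B →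
                 Reply B k (1 + c) r ⊎ Cornered B k (1 + c) r
  chase-follow {B} {k} {c} {r} r-vertex gap r≡ bd with advance-from r r-vertex
  ... | advance r' s r'-vertex r'≡ (inj₁ refl) =
    inj₁ (reply s r'-vertex (chase (s≤s gap) (≡₄-suc r≡) (spend k (4 + c) bd ≤-refl)))
  ... | advance r' s r'-vertex r'≡ (inj₂ (refl , refl)) with ≡₄-gap (≡₄-+4ʳ r≡) gap
  ...   | inj₁ N≡5+c = inj₂ (cornered c N≡5+c bd)
  ...   | inj₂ 9+c≤N =
    inj₁ (reply s r'-vertex (chase (+-cancelˡ-≤ 3 _ _ 9+c≤N) (≡₄-trans r'≡ (≡₄-suc r≡)) (spend k (4 + c) bd ≤-refl)))

  chase-reply : ∀ {B k c c' r} → Vertex c → Vertex r → Vertex c' → 5 + c ≤ r → r ≡₄ 1 + c →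
                suc k + (4 + c) ≤ N + B → Step c c' → Reply B k c' r ⊎ Cornered B k c' r
  chase-reply {B} {k} {c} {c'} {r} (1≤c , _) r-vertex (1≤c' , _) gap r≡ bd = go
    where
    spend-chase : ∀ {x'} → x' ≤ suc (4 + c) → k + x' ≤ N + B
    spend-chase = spend k (4 + c) bd
    6≤5+c : 6 ≤ 5 + c
    6≤5+c = +-monoʳ-≤ 5 1≤c
    4≤r : 4 ≤ r
    4≤r = ≤-trans (m≤m+n 4 (1 + c)) gap
    4≤r' : ∀ {r'} → Advanced r r' → 4 ≤ r'
    4≤r' = advanced-≥ (m≤m+n 3 3) (≤-trans (n≤1+n 3) 4≤r)
    go : Step c c' → Reply B k c' r ⊎ Cornered B k c' r
    go (stay _) with advance-from r r-vertex
    ... | advance r' s r'-vertex r'≡ how =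
      inj₁ (reply s r'-vertex (opposite₀ 1≤c (≡₄-trans r'≡ (≡₄-suc r≡)) (λ _ → 4≤r' how) (spend-chase 6≤5+c)))
    go (up₁ _) = chase-follow r-vertex gap r≡ bd
    go (up₃ _) = inj₁ (reply (stay r) r-vertex (opposite₀ 1≤c' (≡₄-+4ʳ r≡) (λ _ → 4≤r) (spend-chase 6≤5+c)))
    go (up₄ _) with advance-from r r-vertex
    ... | advance r' s r'-vertex r'≡ how =
      inj₁ (reply s r'-vertex (opposite₀ 1≤c' (≡₄-+4ʳ (≡₄-trans r'≡ (≡₄-suc r≡))) (λ _ → 4≤r' how) (spend-chase 6≤5+c)))
    go (down₁ _) = inj₁ (reply (stay r) r-vertex (opposite₀ 1≤c' r≡ (λ _ → 4≤r) (spend-chase 6≤5+c)))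
    go (down₃ _) with advance-from r r-vertex
    ... | advance r' s r'-vertex r'≡ how =
      inj₁ (reply s r'-vertex (chase (+-cancelˡ-≤ 3 _ _ (≤-trans gap (advanced-≤ how)))
                                     (≡₄-4+ʳ (≡₄-trans r'≡ (≡₄-suc r≡))) (spend-chase (≤-trans (m≤n+m _ 3) (n≤1+n _)))))
    go (down₄ _) with advance-from r r-vertex
    ... | advance r' s r'-vertex r'≡ how =
      inj₁ (reply s r'-vertex (opposite₀ 1≤c' (≡₄-4+ʳ (≡₄-trans r'≡ (≡₄-suc r≡))) (λ _ → 4≤r' how) (spend-chase 6≤5+c)))
    go jump₁₃ with retreat-from r r-vertex
    ... | retreat r' s r'-vertex r'≡ r'≥ =
      inj₁ (reply s r'-vertex (opposite₀ 1≤c' (≡₄-trans r'≡ (≡₄-+ 3 r≡)) (λ _ → r'≥ (≤-trans (m≤m+n 5 1) gap))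
                                         (spend-chase 6≤5+c)))
    go jump₃₁ with retreat-from r r-vertex
    ... | retreat r' s r'-vertex r'≡ r'≥ =
      inj₁ (reply s r'-vertex (opposite₀ 1≤c' (≡₄-4+ʳ (≡₄-trans r'≡ (≡₄-+ 3 r≡))) (λ _ → r'≥ (≤-trans (m≤m+n 5 3) gap))
                                         (spend-chase 6≤5+c)))

  at-one-reply : ∀ {B k c' r} → Vertex r → Vertex c' → r ≡₄ 3 → 4 ≤ r → suc k + 6 ≤ N + B → Step 1 c' →
                 Reply B k c' r
  at-one-reply {B} {k} {c'} {r} r-vertex (1≤c' , _) r≡ 4≤r bd = go
    where
    spend-one : ∀ {x'} → x' ≤ 7 → k + x' ≤ N + B
    spend-one = spend k 6 bd
    7≤r : 7 ≤ r
    7≤r = ≡₄-above ≤-refl r≡ (>⇒≢ 4≤r)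
    go : Step 1 c' → Reply B k c' r
    go (stay _) = reply (stay r) r-vertex (at-one r≡ 4≤r (spend-one (n≤1+n 6)))
    go (up₁ _) with advance-from r r-vertex
    ... | advance r' s r'-vertex r'≡ how =
      reply s r'-vertex (opposite₀ (s≤s z≤n) (≡₄-trans r'≡ (≡₄-suc r≡))
                                   (λ _ → advanced-≥ (m≤m+n 3 3) (≤-trans (n≤1+n 3) 4≤r) how) (spend-one (n≤1+n 6)))
    go (up₃ _) with retreat-from r r-vertex
    ... | retreat r' s r'-vertex r'≡ _ =
      reply s r'-vertex (opposite₀ (s≤s z≤n) (≡₄-trans r'≡ (≡₄-+ 3 r≡)) (beyond-3 ≤-refl) (spend-one (n≤1+n 6)))
    go (up₄ _) = reply (stay r) r-vertex (opposite₀ (s≤s z≤n) (≡₄-+4ʳ r≡) (beyond-3 (n≤1+n 4)) (spend-one (n≤1+n 6)))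
    go jump₁₃ with advance-from r r-vertex
    ... | advance r' s r'-vertex r'≡ (inj₁ refl) = reply s r'-vertex (chase (s≤s 7≤r) (≡₄-suc r≡) (spend-one ≤-refl))
    ... | advance r' s r'-vertex r'≡ (inj₂ (refl , _)) with ≡₄-trans (≡₄-sym N≡₄2) r≡
    ...   | mod4 ()

  opposite-down₁ : ∀ {B k c' r} → Vertex r → Vertex c' → r ≡₄ 3 + c' → (1 + c' ≤ 3 → 4 ≤ r) →
                   ∀ q → q * 4 ≤ 5 + (1 + c') → suc k + 6 ≤ N + (q + B) → Reply B k c' r
  opposite-down₁ {B} {k} {1} {r} r-vertex _ r≡ 4≤r q q≤ bd with r ≟ℕ 4
  ... | yes refl =
    reply (up₃ 4) (small-vertex (s≤s z≤n) (m≤m+n 7 3)) (at-one (mod4 refl) (m≤m+n 4 3) (spend-q≤1 k q B q≤ bd))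
  ... | no  r≢4 with ≡₄-gap r≡ (4≤r (m≤m+n 2 1))
  ...   | inj₁ r≡4 = ⊥-elim (r≢4 r≡4)
  ...   | inj₂ 8≤r with retreat-from r r-vertex
  ...     | retreat r' s r'-vertex r'≡ r'≥ =
    reply s r'-vertex (at-one (≡₄-4+ʳ (≡₄-trans r'≡ (≡₄-+ 3 r≡))) (r'≥ (≤-trans (m≤m+n 5 3) 8≤r)) (spend-q≤1 k q B q≤ bd))
  opposite-down₁ {B} {k} {2} {r} r-vertex _ r≡ 4≤r q q≤ bd with retreat-from r r-vertex
  ... | retreat r' s r'-vertex r'≡ r'≥ =
    reply s r'-vertex (opposite-next q (s≤s (s≤s z≤n)) (≡₄-4+ʳ (≡₄-trans r'≡ (≡₄-+ 3 r≡))) (λ _ → r'≥ 5≤r) q≤ (m≤m+n 3 3) bd)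
    where
    5≤r : 5 ≤ r
    5≤r = ≡₄-above (s≤s (s≤s z≤n)) (≡₄-4+ʳ r≡) (>⇒≢ (≤-trans (s≤s (s≤s z≤n)) (4≤r ≤-refl)))
  opposite-down₁ {B} {k} {3} {r} r-vertex _ r≡ 4≤r q q≤ bd with r ≟ℕ 2
  ... | yes refl = reply (up₃ 2) (small-vertex (s≤s z≤n) (m≤m+n 5 5))
                     (opposite-next q (s≤s (s≤s z≤n)) (mod4 refl) (λ _ → m≤m+n 4 1) q≤ (m≤m+n 4 3) bd)
  ... | no  r≢2 with retreat-from r r-vertex
  ...   | retreat r' s r'-vertex r'≡ r'≥ =
    reply s r'-vertex (opposite-next q (s≤s (s≤s z≤n)) (≡₄-4+ʳ (≡₄-trans r'≡ (≡₄-+ 3 r≡)))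
                                     (λ _ → r'≥ (≤-trans (m≤m+n 5 1) 6≤r)) q≤ (m≤m+n 4 3) bd)
    where
    6≤r : 6 ≤ r
    6≤r = ≡₄-above (s≤s (s≤s (s≤s z≤n))) (≡₄-4+ʳ r≡) r≢2
  opposite-down₁ {B} {k} {c'@(suc (suc (suc (suc _))))} {r} r-vertex _ r≡ _ q q≤ bd with retreat-from r r-vertex
  ... | retreat r' s r'-vertex r'≡ _ =
    reply s r'-vertex (opposite-next q (s≤s (s≤s z≤n)) (≡₄-4+ʳ (≡₄-trans r'≡ (≡₄-+ 3 r≡))) (beyond-3 (m≤m+n 4 _))
                                     q≤ (+-monoˡ-≤ c' (m≤m+n 1 3)) bd)

  opposite-down₃ : ∀ {B k c' r} → Vertex r → Vertex c' → r ≡₄ 5 + c' →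
                   ∀ q → q * 4 ≤ 5 + (3 + c') → suc k + 6 ≤ N + (q + B) → Reply B k c' r
  opposite-down₃ {B} {k} {1} {r} r-vertex _ r≡ q q≤ bd with r ≟ℕ 2
  ... | yes refl =
    reply (up₄ 2) (small-vertex (s≤s z≤n) (m≤m+n 6 4)) (chase ≤-refl (mod4 refl) (spend-q≤2 k q B (≤-trans q≤ (n≤1+n 9)) bd))
  ... | no  r≢2  =
    reply (stay r) r-vertex (chase (≡₄-above (s≤s (s≤s (s≤s z≤n))) (≡₄-4+ʳ r≡) r≢2) (≡₄-4+ʳ r≡)
                                   (spend-q≤2 k q B (≤-trans q≤ (n≤1+n 9)) bd))
  opposite-down₃ {B} {k} {c'@(suc (suc _))} {r} r-vertex@(1≤r , _) _ r≡ q q≤ bd with advance-from r r-vertex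
  ... | advance r' s r'-vertex r'≡ how =
    reply s r'-vertex (opposite-next q (s≤s (s≤s z≤n)) (≡₄-4+ʳ (≡₄-trans r'≡ (≡₄-suc r≡)))
                                     (λ c'≤3 → advanced-≥ (m≤m+n 3 3) (3≤r c'≤3) how) q≤ (m≤n+m (3 + c') 1) bd)
    where
    3≤r : c' ≤ 3 → 3 ≤ r
    3≤r (s≤s (s≤s z≤n))       = ≡₄-lower ≤-refl (≡₄-4+ʳ r≡)
    3≤r (s≤s (s≤s (s≤s z≤n))) = ≤-trans (n≤1+n 3) (≡₄-above (s≤s z≤n) (≡₄-4+ʳ (≡₄-4+ʳ r≡)) (m<n⇒n≢0 1≤r))

  opposite-down₄ : ∀ {B k c' r} → Vertex r → Vertex c' → r ≡₄ 6 + c' →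
                   ∀ q → q * 4 ≤ 5 + (4 + c') → suc k + 6 ≤ N + (q + B) → Reply B k c' r
  opposite-down₄ {B} {k} {1} {r} r-vertex _ r≡ q q≤ bd with r ≟ℕ 3
  ... | yes refl = reply (up₃ 3) (small-vertex (s≤s z≤n) (m≤m+n 6 4)) (chase ≤-refl (mod4 refl) (spend-q≤2 k q B q≤ bd))
  ... | no  r≢3 with retreat-from r r-vertex
  ...   | retreat r' s r'-vertex r'≡ r'≥ =
    reply s r'-vertex (chase (r'≥ (≡₄-above ≤-refl (≡₄-4+ʳ r≡) r≢3)) (≡₄-4+ʳ (≡₄-4+ʳ (≡₄-trans r'≡ (≡₄-+ 3 r≡))))
                             (spend-q≤2 k q B q≤ bd))
  opposite-down₄ {B} {k} {2} {r} r-vertex@(1≤r , _) _ r≡ q q≤ bd =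
    reply (stay r) r-vertex (opposite-next q (s≤s (s≤s z≤n)) (≡₄-4+ʳ r≡)
                                           (λ _ → ≡₄-above (s≤s z≤n) (≡₄-4+ʳ (≡₄-4+ʳ r≡)) (m<n⇒n≢0 1≤r)) q≤ ≤-refl bd)
  opposite-down₄ {B} {k} {3} {r} r-vertex _ r≡ q q≤ bd with r ≟ℕ 1
  ... | yes refl = reply (up₄ 1) (small-vertex (s≤s z≤n) (m≤m+n 5 5))
                     (opposite-next q (s≤s (s≤s z≤n)) (mod4 refl) (λ _ → m≤m+n 4 1) q≤ ≤-refl bd)
  ... | no  r≢1  = reply (stay r) r-vertex
                     (opposite-next q (s≤s (s≤s z≤n)) (≡₄-4+ʳ r≡)
                                    (λ _ → ≤-trans (n≤1+n 4) (≡₄-above (s≤s (s≤s z≤n)) (≡₄-4+ʳ (≡₄-4+ʳ r≡)) r≢1))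
                                    q≤ ≤-refl bd)
  opposite-down₄ {B} {k} {suc (suc (suc (suc _)))} {r} r-vertex _ r≡ q q≤ bd =
    reply (stay r) r-vertex (opposite-next q (s≤s (s≤s z≤n)) (≡₄-4+ʳ r≡) (beyond-3 (m≤m+n 4 _)) q≤ ≤-refl bd)

  opposite-reply : ∀ {B k c c' r} → Vertex r → Vertex c' → 2 ≤ c → r ≡₄ 2 + c → (c ≤ 3 → 4 ≤ r) →
                   ∀ q → q * 4 ≤ 5 + c → suc k + 6 ≤ N + (q + B) → Step c c' → Reply B k c' r
  opposite-reply {B} {k} {c} {c'} {r} r-vertex c'-vertex 2≤c r≡ 4≤r q q≤ bd = go
    where
    go : Step c c' → Reply B k c' r
    go (stay _) = reply (stay r) r-vertex (opposite-next q 2≤c r≡ 4≤r q≤ (m≤n+m c 4) bd)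
    go (up₁ _) with advance-from r r-vertex
    ... | advance r' s r'-vertex r'≡ how =
      reply s r'-vertex (opposite-next q (≤-trans 2≤c (n≤1+n c)) (≡₄-trans r'≡ (≡₄-suc r≡))
                                       (λ 1+c≤3 → ≤-trans (n≤1+n 4)
                                                    (advanced-≥ (m≤m+n 4 2) (4≤r (≤-trans (n≤1+n c) 1+c≤3)) how))
                                       q≤ (m≤n+m c 5) bd)
    go (up₃ _) with retreat-from r r-vertex
    ... | retreat r' s r'-vertex r'≡ _ =
      reply s r'-vertex (opposite-next q (≤-trans 2≤c (m≤n+m c 3)) (≡₄-trans r'≡ (≡₄-+ 3 r≡))
                                       (beyond-3 (+-monoʳ-≤ 3 (≤-trans (s≤s z≤n) 2≤c))) q≤ (m≤n+m c 7) bd)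
    go (up₄ _) =
      reply (stay r) r-vertex
        (opposite-next q (≤-trans 2≤c (m≤n+m c 4)) (≡₄-+4ʳ r≡) (beyond-3 (m≤m+n 4 c)) q≤ (m≤n+m c 8) bd)
    go (down₁ _) = opposite-down₁ r-vertex c'-vertex r≡ 4≤r q q≤ bd
    go (down₃ _) = opposite-down₃ r-vertex c'-vertex r≡ q q≤ bd
    go (down₄ _) = opposite-down₄ r-vertex c'-vertex r≡ q q≤ bd
    go jump₁₃ = ⊥-elim (1+n≰n 2≤c)
    go jump₃₁ with advance-from r r-vertex
    ... | advance r' s r'-vertex r'≡ how =
      reply s r'-vertex (chase (advanced-≥ (m≤m+n 5 1) 5≤r how) (≡₄-4+ʳ (≡₄-trans r'≡ (≡₄-suc r≡)))
                               (spend-q≤2 k q B (≤-trans q≤ (m≤m+n 8 2)) bd))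
      where
      5≤r : 5 ≤ r
      5≤r = ≡₄-above (s≤s (s≤s z≤n)) (≡₄-4+ʳ r≡) (>⇒≢ (≤-trans (s≤s (s≤s z≤n)) (4≤r ≤-refl)))

  Survives : ℕ → ℕ → ℕ → Set
  Survives m B k = ∀ c r → Vertex c → Vertex r → Position B k c r → ¬ CopWins k c (replicate (suc m) r)

  CornerEscape : ℕ → ℕ → ℕ → Set
  CornerEscape m B k = k ≤ B → Escape k N-4 (replicate (suc m) N)

  reply-to : ∀ {B k c c' r} → Vertex c → Vertex r → Vertex c' → Position B (suc k) c r → Step c c' →
             Reply B k c' r ⊎ Cornered B k c' r
  reply-to c-vertex r-vertex c'-vertex (chase gap r≡ bd) s = chase-reply c-vertex r-vertex c'-vertex gap r≡ bd s
  reply-to _ r-vertex c'-vertex (at-one r≡ 4≤r bd) s = inj₁ (at-one-reply r-vertex c'-vertex r≡ 4≤r bd s)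
  reply-to _ r-vertex c'-vertex (opposite 2≤c r≡ 4≤r q q≤ bd) s =
    inj₁ (opposite-reply r-vertex c'-vertex 2≤c r≡ 4≤r q q≤ bd s)

  survives-zero : ∀ m B → Survives m B 0
  survives-zero m B c r _ _ _ ()

  survives-suc : ∀ {m B k} → Survives m B k → CornerEscape m B k → Survives m B (suc k)
  survives-suc {m} {B} {k} survives corner c r c-vertex r-vertex pos = robbers-escape (λ ()) flee
    where
    flee : ∀ c' → Adj c c' → Escape k c' (replicate (suc m) r)
    flee c' (s , c'-vertex) with reply-to c-vertex r-vertex c'-vertex pos s
    ... | inj₁ (reply {r'} s' r'-vertex pos') =
      escape-via (replicate (suc m) r') (replicate⁺ (s' , r'-vertex) (suc m)) (survives c' r' c'-vertex r'-vertex pos')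
        (remove-replicate (suc m) (not-adjacent pos s)) (remove-replicate (suc m) (apart pos'))
    ... | inj₂ (refl , refl , k≤B) = corner k≤B

  N-vertex : Vertex N
  N-vertex = top-vertex (s≤s z≤n) ≤-refl

  N-2-vertex : Vertex N-2
  N-2-vertex = top-vertex (s≤s z≤n) (m≤m+n 8 2)

  6≤N : 6 ≤ N
  6≤N = m≤m+n 6 (4 + t * 4)

  single-survives : ∀ k → Survives 0 0 k
  single-survives zero    = survives-zero 0 0
  single-survives (suc k) = survives-suc (single-survives k) stand
    where
    stand : CornerEscape 0 0 k
    stand z≤n = escape-via (N ∷ []) ((stay N , N-vertex) ∷ []) (λ ()) N-stays N-stays
      where
      N-stays : remove N-4 (N ∷ []) ≡ N ∷ []
      N-stays = remove-replicate 1 (top-≢ 10 6 (λ ()))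

  K : ℕ
  K = (2 + t) + (6 + t * 4)

  Split : ℕ → Set
  Split k = k ≤ K → ¬ CopWins k N-4 (N-3 ∷ N-1 ∷ [])

  split-corner : ∀ {k} → Split k → CornerEscape 1 K k
  split-corner split k≤K =
    escape-via (N-3 ∷ N-1 ∷ [])
      ((down₃ N-3 , top-vertex (s≤s z≤n) (m≤m+n 7 3)) ∷ (down₁ N-1 , top-vertex (s≤s z≤n) (m≤m+n 9 1)) ∷ []) (split k≤K)
      (remove-replicate 2 (top-≢ 10 6 (λ ()))) (remove-fresh (top-≢ 7 6 (λ ()) ∷ top-≢ 9 6 (λ ()) ∷ []))

  within-K : ∀ {k x} → suc k ≤ K → x ≤ N → k + x ≤ N + K
  within-K {k} k<K x≤N = ≤-trans (+-mono-≤ (≤-trans (n≤1+n k) k<K) x≤N) (≤-reflexive (+-comm K N))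

  alone-bound : ∀ {k} → suc k ≤ K → k + 6 ≤ N + ((3 + t) + 0)
  alone-bound {k} k<K = ≤-trans (≤-reflexive (+-suc k 5)) (≤-trans (+-monoˡ-≤ 5 k<K) (≤-reflexive (K+5≡ t)))

  regroup : ∀ {k c' x} → Survives 1 K k → Vertex c' → Step N-3 x → Step N-1 x → Vertex x → N-3 ≢ c' → N-1 ≢ c' →
            Position K k c' x → Escape k c' (N-3 ∷ N-1 ∷ [])
  regroup {c' = c'} {x} together c'-vertex s₁ s₂ x-vertex fresh₁ fresh₂ pos =
    escape-via (x ∷ x ∷ []) ((s₁ , x-vertex) ∷ (s₂ , x-vertex) ∷ []) (together c' x c'-vertex x-vertex pos)
      (remove-fresh (fresh₁ ∷ fresh₂ ∷ [])) (remove-replicate 2 (apart pos))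

  one-left : ∀ {k c' y} → Survives 0 0 k → Vertex c' → remove c' (N-3 ∷ N-1 ∷ []) ≡ y ∷ [] → Vertex y →
             Position 0 k c' y → Escape k c' (N-3 ∷ N-1 ∷ [])
  one-left {c' = c'} {y} alone c'-vertex left y-vertex pos =
    escape-via (y ∷ []) ((stay y , y-vertex) ∷ []) (alone c' y c'-vertex y-vertex pos) left (remove-replicate 1 (apart pos))

  split-suc : ∀ {k} → Survives 1 K k → Survives 0 0 k → Split (suc k)
  split-suc {k} together alone k<K = robbers-escape (λ ()) flee
    where
    flee : ∀ c' → Adj N-4 c' → Escape k c' (N-3 ∷ N-1 ∷ [])
    flee c' (stay _ , c'-vertex) =
      regroup together c'-vertex (up₁ N-3) (down₁ N-2) N-2-vertex (top-≢ 7 6 (λ ())) (top-≢ 9 6 (λ ()))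
        (opposite (m≤m+n 2 (4 + t * 4)) (mod4 refl) (beyond-3 (m≤m+n 4 (2 + t * 4))) 0 z≤n (within-K k<K 6≤N))
    flee c' (up₁ _ , c'-vertex) =
      one-left alone c'-vertex (trans (remove-drop {N-3} (N-1 ∷ [])) (remove-fresh (top-≢ 9 7 (λ ()) ∷ [])))
        (top-vertex (s≤s z≤n) (m≤m+n 9 1))
        (opposite (m≤m+n 2 (5 + t * 4)) (mod4 refl) (beyond-3 (m≤m+n 4 (3 + t * 4))) (3 + t) ≤-refl (alone-bound k<K))
    flee c' (up₃ _ , c'-vertex) =
      one-left alone c'-vertex
        (trans (remove-keep {N-1} (N-1 ∷ []) (top-≢ 7 9 (λ ()))) (cong (N-3 ∷_) (remove-drop {N-1} [])))
        (top-vertex (s≤s z≤n) (m≤m+n 7 3))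
        (opposite (m≤m+n 2 (7 + t * 4)) (mod4 refl) (beyond-3 (m≤m+n 4 (5 + t * 4))) (3 + t)
                  (+-monoˡ-≤ (t * 4) (m≤m+n 12 2)) (alone-bound k<K))
    flee c' (up₄ _ , c'-vertex) =
      regroup together c'-vertex (up₁ N-3) (down₁ N-2) N-2-vertex (top-≢ 7 10 (λ ())) (top-≢ 9 10 (λ ()))
        (opposite (m≤m+n 2 (8 + t * 4)) (mod4 refl) (beyond-3 (m≤m+n 4 (6 + t * 4))) 0 z≤n (within-K k<K 6≤N))
    flee c' (down₁ _ , c'-vertex) =
      regroup together c'-vertex (up₃ N-3) (up₁ N-1) N-vertex (top-≢ 7 5 (λ ())) (top-≢ 9 5 (λ ()))
        (chase ≤-refl (mod4 refl) (within-K k<K (n≤1+n _)))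
    flee c' (down₃ _ , c'-vertex) =
      regroup together c'-vertex (up₁ N-3) (down₁ N-2) N-2-vertex (top-≢ 7 3 (λ ())) (top-≢ 9 3 (λ ()))
        (chase ≤-refl (mod4 refl) (within-K k<K (+-monoˡ-≤ (t * 4) (m≤m+n 7 3))))
    flee c' (down₄ _ , c'-vertex) =
      regroup together c'-vertex (up₁ N-3) (down₁ N-2) N-2-vertex (top-≢ 7 2 (λ ())) (top-≢ 9 2 (λ ()))
        (opposite (m≤m+n 2 (t * 4)) (mod4 refl) (λ _ → m≤m+n 4 (4 + t * 4)) 0 z≤n (within-K k<K 6≤N))

  pair-survives : ∀ k → Survives 1 K k × Split k
  pair-survives zero    = survives-zero 1 K , λ _ ()
  pair-survives (suc k) with pair-survives k
  ... | survives , split = survives-suc survives (split-corner split) , split-suc survives (single-survives k)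

  T : ℕ
  T = N-4 + K

  start-bound : ∀ {k} → k < T → k + 5 ≤ N + K
  start-bound {k} k<T = ≤-trans (≤-reflexive (+-suc k 4)) (≤-trans (+-monoˡ-≤ 4 k<T) (≤-reflexive (T+4≡ t)))

  start-bound₁ : ∀ {k} → k < T → k + 6 ≤ N + (1 + K)
  start-bound₁ {k} k<T =
    ≤-trans (≤-reflexive (+-suc k 5)) (≤-trans (s≤s (start-bound k<T)) (≤-reflexive (sym (+-suc N K))))

  start : ∀ c → Vertex c → Σ[ r ∈ ℕ ] Vertex r × (∀ {k} → k < T → Position K k c r)
  start 1 _ = 6 , small-vertex (s≤s z≤n) (m≤m+n 6 4) , λ k<T → chase ≤-refl (mod4 refl) (start-bound k<T)
  start c@(suc (suc c₀)) (_ , c≤N) with 2 + c ≤? N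
  ... | yes 2+c≤N =
    2 + c , (s≤s z≤n , 2+c≤N) ,
    λ k<T → opposite (s≤s (s≤s z≤n)) (mod4 refl) (λ _ → +-monoʳ-≤ 2 (s≤s (s≤s z≤n))) 1 (m≤m+n 4 (1 + c)) (start-bound₁ k<T)
  ... | no  2+c≰N =
    c₀ , (≤-trans (s≤s z≤n) 7≤c₀ , ≤-trans (m≤n+m c₀ 2) c≤N) ,
    λ k<T → opposite (s≤s (s≤s z≤n)) (mod4 refl) (beyond-3 (≤-trans (m≤m+n 4 5) (s≤s (s≤s 7≤c₀)))) 1 (m≤m+n 4 (1 + c))
                     (start-bound₁ k<T)
    where
    7≤c₀ : 7 ≤ c₀
    7≤c₀ = ≤-trans (m≤m+n 7 (t * 4)) (+-cancelˡ-≤ 3 _ _ (≤-pred (≰⇒> 2+c≰N)))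

  open Labelling N

  no-capture-before-T : ∀ s → s < T → ¬ Game.CaptWithin (H N) 2 s
  no-capture-before-T s s<T (c , wins) with start (label c) (label-isVertex c)
  ... | r , r-vertex , pos with vertex-label r-vertex
  ... | r̂ , refl = proj₁ (pair-survives s) (label c) (label r̂) (label-isVertex c) r-vertex (pos s<T) on-labels
    where
    on-labels : CopWins s (label c) (label r̂ ∷ label r̂ ∷ [])
    on-labels =
      subst (CopWins s (label c)) (trans (map-remove c (r̂ ∷ r̂ ∷ [])) (remove-replicate 2 (apart (pos s<T))))
        (copWins⁺ s c _ (wins (r̂ ∷ᵥ r̂ ∷ᵥ []ᵥ)))

capt-H : ∀ t → IsCapt (H (10 + t * 4)) 2 ((6 + t * 4) + ((2 + t) + (6 + t * 4)))
capt-H t =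
  UpperBound.captWithin (10 + t * 4) (2 + t) (4 + t * 4) (s≤s z≤n) ≤-refl (≤-reflexive (cong (4 +_) (+-comm 6 (t * 4)))) ,
  LowerBound.no-capture-before-T t

N≡4ℓ+2 : ∀ t → 10 + t * 4 ≡ 4 * (2 + t) + 2
N≡4ℓ+2 = solve-∀

T≡ℓ+2[N-4] : ∀ t → (6 + t * 4) + ((2 + t) + (6 + t * 4)) ≡ (2 + t) + 2 * (6 + t * 4)
T≡ℓ+2[N-4] = solve-∀

corollary3p6 : (ℓ : ℕ) → 2 ≤ ℓ →
    IsCapt (H (4 * ℓ + 2)) 2 (ℓ + 2 * ((4 * ℓ + 2) ∸ 4))
corollary3p6 (suc (suc t)) (s≤s (s≤s _)) =
  subst (λ n → IsCapt (H n) 2 (2 + t + 2 * (n ∸ 4))) (N≡4ℓ+2 t)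
    (subst (IsCapt (H (10 + t * 4)) 2) (T≡ℓ+2[N-4] t) (capt-H t))
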